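{- For all integers $0 \leq k \leq n$, $\mathrm{frst}(n,k) \leq \mathrm{frst}(n+1,k+1)$.
   Context: A weak partition is a finite non-decreasing sequence of non-negative integers; its parts are its entries, and the multiplicity of a value is the number of entries equal to it. For $0 \leq k \leq n$, $\mathrm{frst}(n,k)$ is the number of weak partitions with exactly $n-k$ parts, each part at most $k$, such that: (a) if $k$ is even, each odd part has even multiplicity; (b) if $k$ is odd, each even part (including $0$) has even multiplicity. -}

module Defs where

open import Data.Nat using (ℕ; zero; suc; _≤_; _≤?_; _∸_; _≟_)
open import Data.Nat.Properties using ()
open import Data.Bool using (Bool; true; false; if_then_else_)
open import Data.List using (List; []; _∷_; length; map; concatMap; upTo; filter)
open import Data.List.Relation.Unary.All using (All; all?)
open import Data.List.Relation.Unary.Linked using (Linked)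
open import Data.List.Relation.Unary.Linked.Properties using ()
open import Data.Product using (_×_)
open import Relation.Nullary using (Dec; yes; no)
open import Relation.Nullary.Decidable using (_×-dec_; _→-dec_)
open import Relation.Unary using (Decidable)
open import Relation.Binary.PropositionalEquality using (_≡_)

isEven : ℕ → Bool
isEven zero = true
isEven (suc zero) = false
isEven (suc (suc n)) = isEven n

Even : ℕ → Set
Even n = isEven n ≡ true

Odd : ℕ → Set
Odd n = isEven n ≡ false

even? : (n : ℕ) → Dec (Even n)
even? n with isEven n
... | true = yes _≡_.refl
... | false = no (λ ())

odd? : (n : ℕ) → Dec (Odd n)
odd? n with isEven n
... | true = no (λ ())
... | false = yes _≡_.refl

-- A weak partition: a finite non-decreasing list of natural numbers.
NonDecreasing : List ℕ → Set
NonDecreasing = Linked _≤_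

nonDecreasing? : (xs : List ℕ) → Dec (NonDecreasing xs)
nonDecreasing? [] = yes Linked.[]
nonDecreasing? (x ∷ []) = yes Linked.[-]
nonDecreasing? (x ∷ y ∷ xs) with x ≤? y | nonDecreasing? (y ∷ xs)
... | yes p | yes q = yes (p Linked.∷ q)
... | no ¬p | _ = no λ { (p Linked.∷ _) → ¬p p }
... | yes _ | no ¬q = no λ { (_ Linked.∷ q) → ¬q q }

multiplicity : ℕ → List ℕ → ℕ
multiplicity v xs = length (filter (_≟ v) xs)

-- Parity condition from the definition of frst(n,k), for a list of parts
-- all of which are at most k:
--   k even: every odd part has even multiplicity;
--   k odd : every even part (including 0) has even multiplicity.
-- (Quantifying over the entries of xs = quantifying over the parts.)
ParityCond : ℕ → List ℕ → Set
ParityCond k xs with isEven k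
... | true  = All (λ p → Odd p → Even (multiplicity p xs)) xs
... | false = All (λ p → Even p → Even (multiplicity p xs)) xs

parityCond? : (k : ℕ) (xs : List ℕ) → Dec (ParityCond k xs)
parityCond? k xs with isEven k
... | true  = all? (λ p → odd? p →-dec even? (multiplicity p xs)) xs
... | false = all? (λ p → even? p →-dec even? (multiplicity p xs)) xs

listsOver : ℕ → ℕ → List (List ℕ)
listsOver zero k = [] ∷ []
listsOver (suc m) k = concatMap (λ x → map (x ∷_) (listsOver m k)) (upTo (suc k))

-- The property counted by frst(n,k) (length n ∸ k and bound ≤ k are
-- guaranteed by enumerating listsOver (n ∸ k) k).
FrstProp : ℕ → List ℕ → Set
FrstProp k xs = NonDecreasing xs × ParityCond k xs

frstProp? : (k : ℕ) → Decidable (FrstProp k)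
frstProp? k xs = nonDecreasing? xs ×-dec parityCond? k xs

-- frst(n,k): number of weak partitions with exactly n − k parts, each part
-- at most k, satisfying the parity condition (meaningful for k ≤ n).
frst : ℕ → ℕ → ℕ
frst n k = length (filter (frstProp? k) (listsOver (n ∸ k) k))

module Submission where

-- Adding one to every part sends a weak partition with n − k
-- parts bounded by k to a weak partition with (n+1) − (k+1) = n − k parts
-- bounded by k + 1.  This shift xs ↦ map suc xs is injective, keeps the list
-- non-decreasing, keeps multiplicities (the multiplicity of p + 1 in the
-- shifted list is that of p), and flips the parity of every part; since it
-- also flips the parity of k, it turns the parity condition for k into the
-- parity condition for k + 1.  Hence frst n k ≤ frst (n+1) (k+1).
--
-- To count, we show that the enumeration listsOver m k, shifted entrywise,
-- occurs in order as a sublist of listsOver m (k+1): a heterogeneous sublist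
-- for the relation "ys is xs shifted".

open import Defs
open import Data.Nat using (ℕ; suc; zero; _≤_; _∸_; _≟_; s≤s)
open import Data.Bool using (true; false; not)
open import Data.Bool.Properties using (not-injective)
open import Data.List using (List; []; _∷_; map; concatMap; upTo)
open import Data.List.Properties using (map-upTo)
open import Data.List.Relation.Unary.All using (All)
open import Data.List.Relation.Unary.All.Properties using (gmap⁺)
open import Data.List.Relation.Unary.Linked as Linked using ()
open import Data.List.Relation.Unary.Linked.Properties as Linked using ()
open import Data.List.Relation.Binary.Sublist.Heterogeneous as Sublist
  using (Sublist; _∷_)
open import Data.List.Relation.Binary.Sublist.Heterogeneous.Properties
  using (length-mono-≤; ⊆-filter-Sublist; ++⁺; ++ˡ; map⁺)
open import Data.Product using (_,_)
open import Relation.Nullary using (does)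
open import Relation.Binary.PropositionalEquality
  using (_≡_; refl; sym; trans; cong; subst)

shift : List ℕ → List ℕ
shift = map suc

Shifted : List ℕ → List ℕ → Set
Shifted xs ys = shift xs ≡ ys

blocks : List (List ℕ) → List ℕ → List (List ℕ)
blocks L xs = concatMap (λ x → map (x ∷_) L) xs

blocks-shifted : ∀ {L L′} → Sublist Shifted L L′ → (xs : List ℕ) →
                 Sublist Shifted (blocks L xs) (blocks L′ (shift xs))
blocks-shifted s []       = Sublist.[]
blocks-shifted s (x ∷ xs) =
  ++⁺ (map⁺ (x ∷_) (suc x ∷_) (Sublist.map (cong (suc x ∷_)) s))
      (blocks-shifted s xs)

-- The shifted enumeration of lists of length m over {0,…,k} is a sublist of
-- the enumeration over {0,…,k+1}: the latter starts with the block of lists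
-- beginning with 0, followed by the blocks beginning with 1,…,k+1, which are
-- the shifted first entries {0,…,k}.
listsOver-shifted : ∀ m k → Sublist Shifted (listsOver m k) (listsOver m (suc k))
listsOver-shifted zero    k = refl ∷ Sublist.[]
listsOver-shifted (suc m) k =
  ++ˡ (map (0 ∷_) (listsOver m (suc k)))
      (subst (λ firsts → Sublist Shifted (listsOver (suc m) k)
                                          (blocks (listsOver m (suc k)) firsts))
             (map-upTo suc (suc k))
             (blocks-shifted (listsOver-shifted m k) (upTo (suc k))))

isEven-suc : ∀ n → isEven (suc n) ≡ not (isEven n)
isEven-suc zero          = refl
isEven-suc (suc zero)    = refl
isEven-suc (suc (suc n)) = isEven-suc n

-- The shift preserves multiplicities: p + 1 occurs in shift xs as often as p
-- occurs in xs.  (The test suc x ≟ suc p computes to the test x ≟ p.)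
multiplicity-shift : ∀ p xs → multiplicity (suc p) (shift xs) ≡ multiplicity p xs
multiplicity-shift p []       = refl
multiplicity-shift p (x ∷ xs) with does (x ≟ p)
... | true  = cong suc (multiplicity-shift p xs)
... | false = multiplicity-shift p xs

nonDecreasing-shift : ∀ {xs} → NonDecreasing xs → NonDecreasing (shift xs)
nonDecreasing-shift nd = Linked.map⁺ (Linked.map s≤s nd)

evenMultiplicities-shift : ∀ b xs →
  All (λ p → isEven p ≡ b → Even (multiplicity p xs)) xs →
  All (λ p → isEven p ≡ not b → Even (multiplicity p (shift xs))) (shift xs)
evenMultiplicities-shift b xs = gmap⁺ shifted
  where
  shifted : ∀ {p} → (isEven p ≡ b → Even (multiplicity p xs)) →
            isEven (suc p) ≡ not b → Even (multiplicity (suc p) (shift xs))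
  shifted {p} h e rewrite multiplicity-shift p xs =
    h (not-injective (trans (sym (isEven-suc p)) e))

parityCond-shift : ∀ k xs → ParityCond k xs → ParityCond (suc k) (shift xs)
parityCond-shift k xs pc with isEven k in eq
... | true  rewrite isEven-suc k | eq = evenMultiplicities-shift false xs pc
... | false rewrite isEven-suc k | eq = evenMultiplicities-shift true xs pc

frstProp-shift : ∀ k {xs ys} → Shifted xs ys → FrstProp k xs → FrstProp (suc k) ys
frstProp-shift k {xs} refl (nd , pc) = nonDecreasing-shift nd , parityCond-shift k xs pc

-- Main result: frst(n,k) ≤ frst(n+1,k+1).  Both sides enumerate lists of
-- length n ∸ k = suc n ∸ suc k (definitionally); filter the shifted embedding
-- of the enumerations and compare lengths.
lemma3p5 : (n k : ℕ) → k ≤ n → frst n k ≤ frst (suc n) (suc k)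
lemma3p5 n k _ =
  length-mono-≤
    (⊆-filter-Sublist (frstProp? k) (frstProp? (suc k)) (frstProp-shift k)
                      (listsOver-shifted (n ∸ k) k))
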